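{- Let $N=[n]$ and let $f:2^N \rightarrow \mathbb{R}_+$ be a submodular function that is $1$-Lipschitz, i.e. $|f(A\cup\{j\})-f(A)| \le 1$ for all $A\subseteq N$, $j\in N$. Then $f$, viewed as a function on $\{0,1\}^n$, is $(2,0)$-self-bounding.
   Context: Functions on $\{0,1\}^n$ are identified with set functions on $[n]$ via $x \mapsto \{j : x_j=1\}$. A set function $f$ is submodular if $f(A\cup B)+f(A\cap B) \le f(A)+f(B)$ for all $A,B\subseteq N$. For $a,b \ge 0$, a function $f:\{0,1\}^n\to\mathbb{R}$ is $(a,b)$-self-bounding if there are functions $f_i:\{0,1\}^{n-1}\to\mathbb{R}$ ($i=1,\dots,n$) such that, writing $x^{(i)}=(x_1,\ldots,x_{i-1},x_{i+1},\ldots,x_n)$, for all $x\in\{0,1\}^n$ and all $i$ we have $0 \le f(x)-f_i(x^{(i)}) \le 1$, and for all $x$ we have $\sum_{i=1}^n (f(x)-f_i(x^{(i)})) \le a f(x) + b$. -}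

module Defs where

open import Data.Nat using (ℕ; zero; suc; pred)
open import Data.Fin using (Fin; zero; suc)
open import Data.Bool using (Bool)
open import Data.Vec using (Vec; removeAt)
open import Data.Fin.Subset using (Subset; _∪_; _∩_; ⁅_⁆)
open import Data.Product using (Σ; ∃; _×_)
open import Relation.Binary.PropositionalEquality using (_≡_)
open import Relation.Binary.Structures using (IsTotalOrder)
open import Relation.Nullary using (¬_)
open import Algebra.Structures using (IsCommutativeRing)

-- Axiomatic real numbers: a complete totally ordered field.
-- (Any model is isomorphic to ℝ.)
record Reals : Set₁ where
  infixl 6 _+_ _-_
  infixl 7 _*_
  infix 4 _≤_
  field
    Carrier : Set
    _+_ _*_ : Carrier → Carrier → Carrier
    -_ : Carrier → Carrier
    0# 1# : Carrier
    _≤_ : Carrier → Carrier → Set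
    isCommutativeRing : IsCommutativeRing _≡_ _+_ _*_ -_ 0# 1#
    isTotalOrder : IsTotalOrder _≡_ _≤_
    0≢1 : ¬ (0# ≡ 1#)
    inverse : ∀ x → ¬ (x ≡ 0#) → Σ Carrier (λ y → x * y ≡ 1#)
    +-mono-≤ : ∀ {x y} z → x ≤ y → x + z ≤ y + z
    *-nonneg : ∀ {x y} → 0# ≤ x → 0# ≤ y → 0# ≤ x * y
    sup : (P : Carrier → Set) → Σ Carrier P →
          Σ Carrier (λ b → ∀ x → P x → x ≤ b) →
          Σ Carrier (λ s → (∀ x → P x → x ≤ s) ×
                           (∀ b → (∀ x → P x → x ≤ b) → s ≤ b))

  _-_ : Carrier → Carrier → Carrier
  x - y = x + (- y)

  2# : Carrier
  2# = 1# + 1#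

module _ (ℝ : Reals) where
  open Reals ℝ

  sumFin : ∀ {n} → (Fin n → Carrier) → Carrier
  sumFin {zero} g = 0#
  sumFin {suc n} g = g zero + sumFin (λ i → g (suc i))

  delete : ∀ {A : Set} {n} → Vec A n → Fin n → Vec A (pred n)
  delete {n = suc n} x i = removeAt x i

  -- subsets of [n] are identified with vectors in {0,1}^n (Subset n = Vec Bool n)
  Submodular : ∀ {n} → (Subset n → Carrier) → Set
  Submodular f = ∀ A B → f (A ∪ B) + f (A ∩ B) ≤ f A + f B

  OneLipschitz : ∀ {n} → (Subset n → Carrier) → Set
  OneLipschitz f = ∀ A j → (- 1# ≤ f (A ∪ ⁅ j ⁆) - f A) × (f (A ∪ ⁅ j ⁆) - f A ≤ 1#)

  Nonneg : ∀ {n} → (Subset n → Carrier) → Set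
  Nonneg f = ∀ A → 0# ≤ f A

  -- (a,b)-self-bounding (a, b ≥ 0 assumed by the caller)
  SelfBounding : ∀ {n} → Carrier → Carrier → (Vec Bool n → Carrier) → Set
  SelfBounding {n} a b f =
    Σ (Fin n → Vec Bool (pred n) → Carrier) λ fs →
      (∀ x i → (0# ≤ f x - fs i (delete x i)) × (f x - fs i (delete x i) ≤ 1#)) ×
      (∀ x → sumFin (λ i → f x - fs i (delete x i)) ≤ a * f x + b)

module Submission where

-- The witness is f_i(y) = min (f (y with i ↦ 0)) (f (y with i ↦ 1)); the
-- 1-Lipschitz condition makes each deficit f(x) − f_i(x^(i)) lie in [0,1].
-- A deficit is nonzero only when moving coordinate i decreases f, and by
-- submodularity the decreases obtained by adding elements to x sum to at most
-- f(x) − f(U) for the set U ⊇ x of all those elements, and likewise those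
-- obtained by removing elements sum to at most f(x) − f(D) for some D ⊆ x.
-- Nonnegativity of f then bounds the total deficit by 2 f(x).

open import Defs
open import Data.Nat using (ℕ; zero; suc; pred)
open import Data.Fin using (Fin; zero; suc)
open import Data.Bool using (Bool)
open import Data.Bool.Properties using (∨-zeroʳ; ∨-identityʳ)
open import Data.Vec using (Vec; []; _∷_; lookup; insertAt; removeAt; _[_]≔_)
open import Data.Vec.Properties using (updateAt-id-local; []≔-idempotent)
open import Data.Fin.Subset using (Subset; _∪_; _∩_; ⁅_⁆; _⊆_; inside; outside)
open import Data.Fin.Subset.Properties
  using (⊆-antisym; q⊆p∪q; p∩q⊆p; x∈p∪q⁻; x∈p∩q⁺; ∪-identityʳ; s⊆s; out⊆)
open import Data.Product using (_×_; _,_; proj₁; proj₂)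
open import Data.Sum using (inj₁; inj₂; [_,_]; [_,_]′)
open import Function using (id)
open import Relation.Binary.PropositionalEquality
  using (_≡_; refl; sym; trans; cong; cong₂; subst; subst₂; module ≡-Reasoning)
open import Relation.Binary.Bundles using (TotalOrder)
open import Relation.Binary.Structures using (IsTotalOrder)
open import Algebra.Bundles using (CommutativeRing)
import Algebra.Properties.Ring as RingProperties
import Algebra.Construct.NaturalChoice.Min as Min

p⊆q⇒p∪q≡q : ∀ {n} {p q : Subset n} → p ⊆ q → p ∪ q ≡ q
p⊆q⇒p∪q≡q {p = p} {q} p⊆q =
  ⊆-antisym (λ x∈p∪q → [ p⊆q , id ] (x∈p∪q⁻ p q x∈p∪q)) (q⊆p∪q p q)

p⊆q⇒p∩q≡p : ∀ {n} {p q : Subset n} → p ⊆ q → p ∩ q ≡ p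
p⊆q⇒p∩q≡p {p = p} {q} p⊆q = ⊆-antisym (p∩q⊆p p q) (λ x∈p → x∈p∩q⁺ (x∈p , p⊆q x∈p))

p∪⁅i⁆≡p[i]≔inside : ∀ {n} (p : Subset n) i → p ∪ ⁅ i ⁆ ≡ p [ i ]≔ inside
p∪⁅i⁆≡p[i]≔inside (s ∷ p) zero    = cong₂ _∷_ (∨-zeroʳ s) (∪-identityʳ p)
p∪⁅i⁆≡p[i]≔inside (s ∷ p) (suc i) = cong₂ _∷_ (∨-identityʳ s) (p∪⁅i⁆≡p[i]≔inside p i)

insertAt-removeAt-≔ : ∀ {A : Set} {n} (xs : Vec A (suc n)) i (v : A) →
                      insertAt (removeAt xs i) i v ≡ xs [ i ]≔ v
insertAt-removeAt-≔ (x ∷ xs)     zero    v = refl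
insertAt-removeAt-≔ (x ∷ y ∷ xs) (suc i) v = cong (x ∷_) (insertAt-removeAt-≔ (y ∷ xs) i v)

module OrderedField (ℝ : Reals) where

  open Reals ℝ

  commutativeRing : CommutativeRing _ _
  commutativeRing = record { isCommutativeRing = isCommutativeRing }

  totalOrder : TotalOrder _ _ _
  totalOrder = record { isTotalOrder = isTotalOrder }

  open CommutativeRing commutativeRing
    using (ring; +-assoc; +-comm; +-identityˡ; +-identityʳ; -‿inverseʳ; distribʳ; *-identityˡ)
  open RingProperties ring
    using (-0#≈0#; -‿involutive; //-rightDividesʳ; xyx⁻¹≈y; ⁻¹-anti-homo-//; -1*x≈-x)
  open IsTotalOrder isTotalOrder using (total) renaming (reflexive to ≤-reflexive; trans to ≤-trans)
  open Min totalOrder public using (_⊓_; x⊓y≤x; ⊓-sel; ⊓-comm)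

  InUnitInterval : Carrier → Set
  InUnitInterval t = (0# ≤ t) × (t ≤ 1#)

  +-monoʳ-≤ : ∀ z {x y} → x ≤ y → z + x ≤ z + y
  +-monoʳ-≤ z {x} {y} x≤y = subst₂ _≤_ (+-comm x z) (+-comm y z) (+-mono-≤ z x≤y)

  x≤y⇒0≤y-x : ∀ {x y} → x ≤ y → 0# ≤ y - x
  x≤y⇒0≤y-x {x} x≤y = subst (_≤ _) (-‿inverseʳ x) (+-mono-≤ (- x) x≤y)

  neg-mono-≤ : ∀ {x y} → x ≤ y → - y ≤ - x
  neg-mono-≤ {x} {y} x≤y =
    subst₂ _≤_ (xyx⁻¹≈y x (- y)) (+-identityˡ (- x))
      (+-mono-≤ (- x) (subst (_ ≤_) (-‿inverseʳ y) (+-mono-≤ (- y) x≤y)))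

  -1≤y-x⇒x-y≤1 : ∀ {x y} → - 1# ≤ y - x → x - y ≤ 1#
  -1≤y-x⇒x-y≤1 {x} {y} h = subst₂ _≤_ (⁻¹-anti-homo-// y x) (-‿involutive 1#) (neg-mono-≤ h)

  0≤1 : 0# ≤ 1#
  0≤1 with total 0# 1#
  ... | inj₁ 0≤1′ = 0≤1′
  ... | inj₂ 1≤0 = subst (0# ≤_) -1*-1≡1 (*-nonneg 0≤-1 0≤-1)
    where
    0≤-1 : 0# ≤ - 1#
    0≤-1 = subst (_≤ - 1#) -0#≈0# (neg-mono-≤ 1≤0)
    -1*-1≡1 : - 1# * - 1# ≡ 1#
    -1*-1≡1 = trans (-1*x≈-x (- 1#)) (-‿involutive 1#)

  x-x+y≤y : ∀ x y → x - x + y ≤ y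
  x-x+y≤y x y = ≤-reflexive (trans (cong (_+ y) (-‿inverseʳ x)) (+-identityˡ y))

  a+b≤c+d⇒a-d+b≤c : ∀ {a b c d} → a + b ≤ c + d → a - d + b ≤ c
  a+b≤c+d⇒a-d+b≤c {a} {b} {c} {d} h =
    subst₂ _≤_ a+b-d≡a-d+b (//-rightDividesʳ d c) (+-mono-≤ (- d) h)
    where
    open ≡-Reasoning
    a+b-d≡a-d+b : a + b - d ≡ a - d + b
    a+b-d≡a-d+b = begin
      a + b + - d    ≡⟨ +-assoc a b (- d) ⟩
      a + (b + - d)  ≡⟨ cong (a +_) (+-comm b (- d)) ⟩
      a + (- d + b)  ≡⟨ +-assoc a (- d) b ⟨
      a - d + b      ∎

  x+y≤z⇒x≤z : ∀ {x y z} → 0# ≤ y → x + y ≤ z → x ≤ z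
  x+y≤z⇒x≤z {x} {y} 0≤y x+y≤z =
    ≤-trans (subst (_≤ x + y) (+-identityʳ x) (+-monoʳ-≤ x 0≤y)) x+y≤z

  x+x≡2x+0 : ∀ x → x + x ≡ 2# * x + 0#
  x+x≡2x+0 x = sym (begin
    (1# + 1#) * x + 0#  ≡⟨ +-identityʳ _ ⟩
    (1# + 1#) * x       ≡⟨ distribʳ x 1# 1# ⟩
    1# * x + 1# * x     ≡⟨ cong₂ _+_ (*-identityˡ x) (*-identityˡ x) ⟩
    x + x               ∎)
    where open ≡-Reasoning

  replaceˡ-≤ : ∀ {g s u u′ w X} → s + u + w ≤ X → g + u′ ≤ u → g + s + u′ + w ≤ X
  replaceˡ-≤ {g} {s} {u} {u′} {w} bound g+u′≤u =
    ≤-trans (subst (_≤ s + u + w) (cong (_+ w) rearrange) (+-mono-≤ w (+-monoʳ-≤ s g+u′≤u))) bound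
    where
    rearrange : s + (g + u′) ≡ g + s + u′
    rearrange = trans (sym (+-assoc s g u′)) (cong (_+ u′) (+-comm s g))

  replaceʳ-≤ : ∀ {g s u w w′ X} → s + u + w ≤ X → g + w′ ≤ w → g + s + u + w′ ≤ X
  replaceʳ-≤ {g} {s} {u} {w} {w′} bound g+w′≤w =
    ≤-trans (subst (_≤ s + u + w) rearrange (+-monoʳ-≤ (s + u) g+w′≤w)) bound
    where
    open ≡-Reasoning
    rearrange : s + u + (g + w′) ≡ g + s + u + w′
    rearrange = begin
      s + u + (g + w′)  ≡⟨ +-assoc (s + u) g w′ ⟨
      s + u + g + w′    ≡⟨ cong (_+ w′) (+-comm (s + u) g) ⟩
      g + (s + u) + w′  ≡⟨ cong (_+ w′) (+-assoc g s u) ⟨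
      g + s + u + w′    ∎

  a-a⊓c∈[0,1] : ∀ {a c} → a - c ≤ 1# → InUnitInterval (a - a ⊓ c)
  a-a⊓c∈[0,1] {a} {c} a-c≤1 = x≤y⇒0≤y-x (x⊓y≤x a c) , [ when-a , when-c ]′ (⊓-sel a c)
    where
    when-a : a ⊓ c ≡ a → a - a ⊓ c ≤ 1#
    when-a e = subst (λ m → a - m ≤ 1#) (sym e) (subst (_≤ 1#) (sym (-‿inverseʳ a)) 0≤1)
    when-c : a ⊓ c ≡ c → a - a ⊓ c ≤ 1#
    when-c e = subst (λ m → a - m ≤ 1#) (sym e) a-c≤1

module MinOverCoordinate (ℝ : Reals) where

  open Reals ℝ
  open OrderedField ℝ
  open IsTotalOrder isTotalOrder using () renaming (reflexive to ≤-reflexive)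
  open CommutativeRing commutativeRing using (+-comm; +-identityˡ)

  deficit : ∀ {n} → (Subset n → Carrier) → Subset n → Fin n → Carrier
  deficit f x i = f x - f (x [ i ]≔ outside) ⊓ f (x [ i ]≔ inside)

  deficit∈[0,1] : ∀ {n} (f : Subset n → Carrier) → OneLipschitz ℝ f →
                  ∀ x i → InUnitInterval (deficit f x i)
  deficit∈[0,1] f lipschitz x i with lookup x i in xᵢ
  ... | outside =
    subst₂ (λ x₀ x₁ → InUnitInterval (f x - f x₀ ⊓ f x₁))
      (sym (updateAt-id-local i x (sym xᵢ))) (p∪⁅i⁆≡p[i]≔inside x i)
      (a-a⊓c∈[0,1] (-1≤y-x⇒x-y≤1 (proj₁ (lipschitz x i))))
  ... | inside = subst (λ m → InUnitInterval (f x - m)) min-swap (a-a⊓c∈[0,1] fx-fx₀≤1)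
    where
    x₀ : Subset _
    x₀ = x [ i ]≔ outside
    x[i]≔inside≡x : x [ i ]≔ inside ≡ x
    x[i]≔inside≡x = updateAt-id-local i x (sym xᵢ)
    x₀∪⁅i⁆≡x : x₀ ∪ ⁅ i ⁆ ≡ x
    x₀∪⁅i⁆≡x = trans (p∪⁅i⁆≡p[i]≔inside x₀ i) (trans ([]≔-idempotent x i) x[i]≔inside≡x)
    fx-fx₀≤1 : f x - f x₀ ≤ 1#
    fx-fx₀≤1 = subst (λ y → f y - f x₀ ≤ 1#) x₀∪⁅i⁆≡x (proj₂ (lipschitz x₀ i))
    min-swap : f x ⊓ f x₀ ≡ f x₀ ⊓ f (x [ i ]≔ inside)
    min-swap = trans (⊓-comm (f x) (f x₀)) (cong (λ y → f x₀ ⊓ f y) (sym x[i]≔inside≡x))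

  submodular-∷ : ∀ {n} {f : Subset (suc n) → Carrier} → Submodular ℝ f →
                 ∀ b → Submodular ℝ (λ y → f (b ∷ y))
  submodular-∷ submodular outside A B = submodular (outside ∷ A) (outside ∷ B)
  submodular-∷ submodular inside  A B = submodular (inside ∷ A) (inside ∷ B)

  submodular-exchange : ∀ {n} {f : Subset (suc n) → Carrier} → Submodular ℝ f →
                        ∀ {A B} → A ⊆ B →
                        f (inside ∷ B) + f (outside ∷ A) ≤ f (inside ∷ A) + f (outside ∷ B)
  submodular-exchange {f = f} submodular {A} {B} A⊆B =
    subst₂ (λ A∪B A∩B → f (inside ∷ A∪B) + f (outside ∷ A∩B) ≤ f (inside ∷ A) + f (outside ∷ B))
      (p⊆q⇒p∪q≡q A⊆B) (p⊆q⇒p∩q≡p A⊆B) (submodular (inside ∷ A) (outside ∷ B))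

  record Sandwich {n} (f : Subset n → Carrier) (x : Subset n) : Set where
    field
      lower upper   : Subset n
      lower⊆x       : lower ⊆ x
      x⊆upper       : x ⊆ upper
      deficit-bound : sumFin ℝ (deficit f x) + f upper + f lower ≤ f x + f x

  subst-subtrahend : ∀ {a m c y z} → m ≡ c → a - c + y ≤ z → a - m + y ≤ z
  subst-subtrahend refl h = h

  -- A nonzero deficit at coordinate 0 is paid for, via submodularity, by moving
  -- coordinate 0 of the upper set up or of the lower set down.
  sandwich : ∀ {n} (f : Subset n → Carrier) → Submodular ℝ f → ∀ x → Sandwich f x
  sandwich f submodular [] = record
    { lower = [] ; upper = [] ; lower⊆x = id ; x⊆upper = id
    ; deficit-bound = ≤-reflexive (cong (_+ f []) (+-identityˡ (f [])))
    }
  sandwich f submodular (outside ∷ x) with ⊓-sel (f (outside ∷ x)) (f (inside ∷ x))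
  ... | inj₁ min≡a₀ = record
    { lower = outside ∷ lower ; upper = outside ∷ upper
    ; lower⊆x = s⊆s lower⊆x ; x⊆upper = s⊆s x⊆upper
    ; deficit-bound = replaceˡ-≤ deficit-bound (subst-subtrahend min≡a₀ (x-x+y≤y _ _))
    }
    where open Sandwich (sandwich _ (submodular-∷ submodular outside) x)
  ... | inj₂ min≡a₁ = record
    { lower = outside ∷ lower ; upper = inside ∷ upper
    ; lower⊆x = s⊆s lower⊆x ; x⊆upper = out⊆ x⊆upper
    ; deficit-bound = replaceˡ-≤ deficit-bound (subst-subtrahend min≡a₁
        (a+b≤c+d⇒a-d+b≤c (subst₂ _≤_ (+-comm _ _) (+-comm _ _)
          (submodular-exchange submodular x⊆upper))))
    }
    where open Sandwich (sandwich _ (submodular-∷ submodular outside) x)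
  sandwich f submodular (inside ∷ x) with ⊓-sel (f (outside ∷ x)) (f (inside ∷ x))
  ... | inj₁ min≡a₀ = record
    { lower = outside ∷ lower ; upper = inside ∷ upper
    ; lower⊆x = out⊆ lower⊆x ; x⊆upper = s⊆s x⊆upper
    ; deficit-bound = replaceʳ-≤ deficit-bound (subst-subtrahend min≡a₀
        (a+b≤c+d⇒a-d+b≤c (submodular-exchange submodular lower⊆x)))
    }
    where open Sandwich (sandwich _ (submodular-∷ submodular inside) x)
  ... | inj₂ min≡a₁ = record
    { lower = inside ∷ lower ; upper = inside ∷ upper
    ; lower⊆x = s⊆s lower⊆x ; x⊆upper = s⊆s x⊆upper
    ; deficit-bound = replaceˡ-≤ deficit-bound (subst-subtrahend min≡a₁ (x-x+y≤y _ _))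
    }
    where open Sandwich (sandwich _ (submodular-∷ submodular inside) x)

  sumFin-deficit≤2f : ∀ {n} (f : Subset n → Carrier) → Nonneg ℝ f → Submodular ℝ f →
                      ∀ x → sumFin ℝ (deficit f x) ≤ f x + f x
  sumFin-deficit≤2f f nonneg submodular x =
    x+y≤z⇒x≤z (nonneg upper) (x+y≤z⇒x≤z (nonneg lower) deficit-bound)
    where open Sandwich (sandwich f submodular x)

  minCompletion : ∀ {n} → (Subset n → Carrier) → Fin n → Vec Bool (pred n) → Carrier
  minCompletion {suc n} f i y = f (insertAt y i outside) ⊓ f (insertAt y i inside)

  f-minCompletion≡deficit : ∀ {n} (f : Subset n → Carrier) x i →
                            f x - minCompletion f i (delete ℝ x i) ≡ deficit f x i
  f-minCompletion≡deficit {suc n} f x i =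
    cong₂ (λ x₀ x₁ → f x - f x₀ ⊓ f x₁)
      (insertAt-removeAt-≔ x i outside) (insertAt-removeAt-≔ x i inside)

  sumFin-cong : ∀ {n} {g h : Fin n → Carrier} → (∀ i → g i ≡ h i) → sumFin ℝ g ≡ sumFin ℝ h
  sumFin-cong {zero}  g≗h = refl
  sumFin-cong {suc n} g≗h = cong₂ _+_ (g≗h zero) (sumFin-cong (λ i → g≗h (suc i)))

lemma3 : (ℝ : Reals) → (n : ℕ) → (f : Subset n → Reals.Carrier ℝ) →
         Nonneg ℝ f → Submodular ℝ f → OneLipschitz ℝ f →
         SelfBounding ℝ (Reals.2# ℝ) (Reals.0# ℝ) f
lemma3 ℝ n f nonneg submodular lipschitz = minCompletion f , deficits∈[0,1] , sum≤2f
  where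
  open Reals ℝ
  open OrderedField ℝ
  open MinOverCoordinate ℝ

  deficits∈[0,1] : ∀ x i → InUnitInterval (f x - minCompletion f i (delete ℝ x i))
  deficits∈[0,1] x i =
    subst InUnitInterval (sym (f-minCompletion≡deficit f x i)) (deficit∈[0,1] f lipschitz x i)

  sum≤2f : ∀ x → sumFin ℝ (λ i → f x - minCompletion f i (delete ℝ x i)) ≤ 2# * f x + 0#
  sum≤2f x =
    subst₂ _≤_ (sumFin-cong (λ i → sym (f-minCompletion≡deficit f x i))) (x+x≡2x+0 (f x))
      (sumFin-deficit≤2f f nonneg submodular x)
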